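{- Let $G$ be a forest with $\omega$ connected components, none of which is trivial (a single vertex). Then $[\omega+1]\subseteq\Upsilon(G)$.
   Context: All graphs are finite and simple. For a positive integer $p$ and a digraph $D=(V,A)$ with $A\subseteq V\times V$ (loops allowed), the $p$-competition graph $C_p(D)$ has vertex set $V$, and distinct $x,y$ are adjacent iff there are $p$ distinct vertices $a_1,\dots,a_p\in V$ with $(x,a_i),(y,a_i)\in A$ for all $i$. A graph is a $p$-competition graph if it equals $C_p(D)$ for some digraph $D$. For a graph $G$ with $n$ vertices, $\Upsilon(G)=\{p\in\{1,\dots,n\}\mid G\text{ is a }p\text{ -competition graph}\}$; $[k]=\{1,\dots,k\}$. -}

module Defs where

open import Level using (0ℓ)
open import Data.Nat using (ℕ; zero; suc; _≤_)
open import Data.Fin using (Fin; zero; suc; inject₁; fromℕ)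
open import Data.Product using (Σ; ∃; _×_; _,_)
open import Relation.Nullary using (¬_)
open import Relation.Binary.PropositionalEquality using (_≡_; _≢_)
open import Function.Definitions using (Injective)
open import Function.Bundles using (_⇔_)

record Graph (n : ℕ) : Set₁ where
  field
    Adj    : Fin n → Fin n → Set
    sym    : ∀ {x y} → Adj x y → Adj y x
    irrefl : ∀ {x} → ¬ Adj x x
open Graph public

Digraph : ℕ → Set₁
Digraph n = Fin n → Fin n → Set

PCompete : ∀ {n} → ℕ → Digraph n → Fin n → Fin n → Set
PCompete {n} p D x y =
  Σ (Fin p → Fin n) λ a → Injective _≡_ _≡_ a × (∀ i → D x (a i) × D y (a i))

-- G = C_p(D): distinct x,y adjacent in G iff they p-compete in D
-- (vertex sets coincide by construction; diagonal is irrelevant as both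
--  G and C_p(D) are loopless).
IsCompetitionGraphOf : ∀ {n} → ℕ → Graph n → Digraph n → Set
IsCompetitionGraphOf p G D = ∀ x y → x ≢ y → (Adj G x y ⇔ PCompete p D x y)

IsPCompetitionGraph : ∀ {n} → ℕ → Graph n → Set₁
IsPCompetitionGraph {n} p G = Σ (Digraph n) λ D → IsCompetitionGraphOf p G D

InUpsilon : ∀ {n} → ℕ → Graph n → Set₁
InUpsilon {n} p G = (1 ≤ p × p ≤ n) × IsPCompetitionGraph p G

data Connected {n} (G : Graph n) : Fin n → Fin n → Set where
  here : ∀ {x} → Connected G x x
  step : ∀ {x y z} → Adj G x y → Connected G y z → Connected G x z

HasCycle : ∀ {n} → Graph n → Set
HasCycle {n} G =
  Σ ℕ λ m → Σ (Fin (suc (suc (suc m))) → Fin n) λ v →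
    Injective _≡_ _≡_ v ×
    (∀ (i : Fin (suc (suc m))) → Adj G (v (inject₁ i)) (v (suc i))) ×
    Adj G (v (fromℕ (suc (suc m)))) (v zero)

IsForest : ∀ {n} → Graph n → Set
IsForest G = ¬ HasCycle G

-- G has exactly ω connected components: a surjective labelling of the
-- vertices by Fin ω whose fibres are exactly the connectivity classes.
HasComponents : ∀ {n} → Graph n → ℕ → Set
HasComponents {n} G ω =
  Σ (Fin n → Fin ω) λ c →
    (∀ k → ∃ λ x → c x ≡ k) ×
    (∀ x y → (c x ≡ c y) ⇔ Connected G x y)

NoTrivialComponent : ∀ {n} → Graph n → Set
NoTrivialComponent {n} G = ∀ x → ∃ λ y → y ≢ x × Connected G x y

-- Root every component at a chosen vertex and let parent v be the next vertex on a shortest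
-- walk from v to its root. Two ancestor chains starting at the ends of an edge x y meet; up from
-- x and down to y they form a path which, closed by the edge, would be a cycle unless it is the
-- single step from x to its parent. So every edge is {a, parent a} for a non-root a. For
-- p = q + 1 ≤ ω + 1 let every vertex prey on the roots of q components, and a and parent a prey
-- on a. The ends of an edge then share q + 1 prey; conversely q + 1 common prey cannot all be
-- roots, and a common non-root prey a forces {x, y} = {a, parent a}. Finally ω < n, as a
-- nontrivial component has a vertex besides its root.
module Submission where

open import Defs renaming (sym to adj-sym; irrefl to adj-irrefl)
open import Data.Nat using (ℕ; zero; suc; _+_; _∸_; _≤_; _<_; z≤n; s≤s; s≤s⁻¹; _<?_; _≟_)
open import Data.Nat.Properties
open import Data.Fin using (Fin; toℕ; inject₁; inject≤; fromℕ; fromℕ<) renaming (zero to fzero; suc to fsuc)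
import Data.Fin.Properties as Fin
open import Data.Product using (∃; _×_; _,_; proj₁; proj₂)
open import Data.Sum using (_⊎_; inj₁; inj₂)
open import Data.Empty using (⊥-elim)
open import Relation.Nullary using (¬_; Dec; yes; no; contradiction)
open import Relation.Nullary.Decidable using (_×-dec_)
open import Relation.Unary using (Decidable)
open import Relation.Binary.PropositionalEquality
open import Function.Bundles using (Equivalence; mk⇔)

splitAt : ∀ L t → t < L ⊎ ∃ λ r → t ≡ L + r
splitAt L t with t <? L
... | yes t<L = inj₁ t<L
... | no t≮L = inj₂ (t ∸ L , sym (m+[n∸m]≡n (≮⇒≥ t≮L)))

m∸o≡n∸p⇒o≡p+[m∸n] : ∀ {m n o p} → n ≤ m → o ≤ m → p ≤ n → m ∸ o ≡ n ∸ p → o ≡ p + (m ∸ n)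
m∸o≡n∸p⇒o≡p+[m∸n] {m} {n} {o} {p} n≤m o≤m p≤n e = +-cancelˡ-≡ (m ∸ o) o (p + (m ∸ n)) (begin
  (m ∸ o) + o               ≡⟨ m∸n+n≡m o≤m ⟩
  m                         ≡⟨ sym (m∸n+n≡m n≤m) ⟩
  (m ∸ n) + n               ≡⟨ cong ((m ∸ n) +_) (sym (m∸n+n≡m p≤n)) ⟩
  (m ∸ n) + ((n ∸ p) + p)   ≡⟨ cong (λ k → (m ∸ n) + (k + p)) (sym e) ⟩
  (m ∸ n) + ((m ∸ o) + p)   ≡⟨ +-comm (m ∸ n) _ ⟩
  ((m ∸ o) + p) + (m ∸ n)   ≡⟨ +-assoc (m ∸ o) p (m ∸ n) ⟩
  (m ∸ o) + (p + (m ∸ n))   ∎)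
  where open ≡-Reasoning

m+n+m≡1⇒m≡0×n≡1 : ∀ m n → m + n + m ≡ 1 → m ≡ 0 × n ≡ 1
m+n+m≡1⇒m≡0×n≡1 zero    n e = refl , trans (sym (+-identityʳ n)) e
m+n+m≡1⇒m≡0×n≡1 (suc m) n e = contradiction (trans (sym (+-suc (m + n) m)) (suc-injective e)) λ ()

least : ∀ {P : ℕ → Set} → Decidable P → ∀ {K} → P K →
        ∃ λ k → P k × (∀ {j} → j < k → ¬ P j)
least P? {K} pK with P? 0
... | yes p0 = 0 , p0 , λ ()
least P? {zero}  pK | no ¬p0 = contradiction pK ¬p0
least P? {suc K} pK | no ¬p0 with least (λ k → P? (suc k)) pK
... | k , pk , below = suc k , pk , λ { {zero} _ → ¬p0 ; {suc j} (s≤s j<k) → below j<k }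

module _ {A : Set} where

  cons : A → (ℕ → A) → ℕ → A
  cons x f zero    = x
  cons x f (suc t) = f t

  concat : ℕ → (ℕ → A) → (ℕ → A) → ℕ → A
  concat zero    f g t       = g t
  concat (suc L) f g zero    = f zero
  concat (suc L) f g (suc t) = concat L (λ s → f (suc s)) g t

  concat-left : ∀ L (f g : ℕ → A) {t} → f L ≡ g 0 → t ≤ L → concat L f g t ≡ f t
  concat-left zero    f g e z≤n     = sym e
  concat-left (suc L) f g e z≤n     = refl
  concat-left (suc L) f g e (s≤s t≤L) = concat-left L (λ s → f (suc s)) g e t≤L

  concat-right : ∀ L (f g : ℕ → A) t → concat L f g (L + t) ≡ g t
  concat-right zero    f g t = refl
  concat-right (suc L) f g t = concat-right L (λ s → f (suc s)) g t

module _ {n} (G : Graph n) where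

  -- Only the values of vertex at 0 … len matter.
  record Path (x y : Fin n) : Set where
    field
      len       : ℕ
      vertex    : ℕ → Fin n
      start     : vertex 0 ≡ x
      end       : vertex len ≡ y
      adjacent  : ∀ t → t < len → Adj G (vertex t) (vertex (suc t))
      injective : ∀ {s t} → s ≤ len → t ≤ len → vertex s ≡ vertex t → s ≡ t

open Path public

module _ {n} {G : Graph n} where

  trivial : ∀ {x} → Path G x x
  trivial {x} = record
    { len = 0 ; vertex = λ _ → x ; start = refl ; end = refl
    ; adjacent = λ _ () ; injective = λ { z≤n z≤n _ → refl } }

  prepend : ∀ {x y z} → Adj G x y → (P : Path G y z) →
            (∀ {t} → t ≤ len P → vertex P t ≢ x) → Path G x z
  prepend {x} a P x∉P = record
    { len = suc (len P) ; vertex = cons x (vertex P) ; start = refl ; end = end P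
    ; adjacent = adj ; injective = inj }
    where
      adj : ∀ t → t < suc (len P) → Adj G (cons x (vertex P) t) (cons x (vertex P) (suc t))
      adj zero    _         = subst (Adj G x) (sym (start P)) a
      adj (suc t) (s≤s t<L) = adjacent P t t<L
      inj : ∀ {s t} → s ≤ suc (len P) → t ≤ suc (len P) →
            cons x (vertex P) s ≡ cons x (vertex P) t → s ≡ t
      inj {zero}  {zero}  _         _         _ = refl
      inj {zero}  {suc t} _         (s≤s t≤L) e = contradiction (sym e) (x∉P t≤L)
      inj {suc s} {zero}  (s≤s s≤L) _         e = contradiction e (x∉P s≤L)
      inj {suc s} {suc t} (s≤s s≤L) (s≤s t≤L) e = cong suc (injective P s≤L t≤L e)

  suffix : ∀ {x z} (P : Path G x z) {t} → t ≤ len P → Path G (vertex P t) z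
  suffix P {t} t≤L = record
    { len = len P ∸ t ; vertex = λ s → vertex P (t + s)
    ; start = cong (vertex P) (+-identityʳ t)
    ; end = trans (cong (vertex P) (m+[n∸m]≡n t≤L)) (end P)
    ; adjacent = adj ; injective = inj }
    where
      shift : ∀ {s} → s ≤ len P ∸ t → t + s ≤ len P
      shift s≤ = subst (_ ≤_) (m+[n∸m]≡n t≤L) (+-monoʳ-≤ t s≤)
      adj : ∀ s → s < len P ∸ t → Adj G (vertex P (t + s)) (vertex P (t + suc s))
      adj s s< = subst (λ u → Adj G (vertex P (t + s)) (vertex P u)) (sym (+-suc t s))
                   (adjacent P (t + s) (subst (_≤ len P) (+-suc t s) (shift s<)))
      inj : ∀ {s s′} → s ≤ len P ∸ t → s′ ≤ len P ∸ t → vertex P (t + s) ≡ vertex P (t + s′) → s ≡ s′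
      inj s≤ s′≤ e = +-cancelˡ-≡ t _ _ (injective P (shift s≤) (shift s′≤) e)

  shortcut : ∀ {x y} → Connected G x y → Path G x y
  shortcut here = trivial
  shortcut {x} (step a c) with P ← shortcut c
    with Fin.any? (λ (i : Fin (suc (len P))) → vertex P (toℕ i) Fin.≟ x)
  ... | yes (i , e) = subst (λ u → Path G u _) e (suffix P (s≤s⁻¹ (Fin.toℕ<n i)))
  ... | no x∉P = prepend a P λ {t} t≤L e →
          x∉P (fromℕ< (s≤s t≤L) , trans (cong (vertex P) (Fin.toℕ-fromℕ< (s≤s t≤L))) e)

  reverse : ∀ {x y} → Path G x y → Path G y x
  reverse P = record
    { len = len P ; vertex = λ t → vertex P (len P ∸ t)
    ; start = end P
    ; end = trans (cong (vertex P) (n∸n≡0 (len P))) (start P)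
    ; adjacent = adj ; injective = inj }
    where
      adj : ∀ t → t < len P → Adj G (vertex P (len P ∸ t)) (vertex P (len P ∸ suc t))
      adj t t<L = adj-sym G (subst (λ u → Adj G (vertex P (len P ∸ suc t)) (vertex P u))
                    (sym step-back) (adjacent P _ (subst (_≤ len P) step-back (m∸n≤m (len P) t))))
        where
          step-back : len P ∸ t ≡ suc (len P ∸ suc t)
          step-back = +-∸-assoc 1 t<L
      inj : ∀ {s t} → s ≤ len P → t ≤ len P → vertex P (len P ∸ s) ≡ vertex P (len P ∸ t) → s ≡ t
      inj {s} {t} s≤L t≤L e = ∸-cancelˡ-≡ s≤L t≤L (injective P (m∸n≤m _ s) (m∸n≤m _ t) e)

  join : ∀ {x y z} (P : Path G x y) (Q : Path G y z) →
         (∀ {s t} → s ≤ len P → t ≤ len Q → vertex P s ≡ vertex Q t → t ≡ 0) → Path G x z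
  join P Q disjoint = record
    { len = len P + len Q ; vertex = v
    ; start = trans (left z≤n) (start P)
    ; end = trans (concat-right (len P) _ _ (len Q)) (end Q)
    ; adjacent = adj ; injective = inj }
    where
      v : ℕ → Fin n
      v = concat (len P) (vertex P) (vertex Q)
      left : ∀ {t} → t ≤ len P → v t ≡ vertex P t
      left = concat-left (len P) _ _ (trans (end P) (sym (start Q)))
      right : ∀ r → v (len P + r) ≡ vertex Q r
      right = concat-right (len P) _ _
      adj : ∀ t → t < len P + len Q → Adj G (v t) (v (suc t))
      adj t t< with splitAt (len P) t
      ... | inj₁ t<L = subst₂ (Adj G) (sym (left (<⇒≤ t<L))) (sym (left t<L)) (adjacent P t t<L)
      ... | inj₂ (r , refl) =
            subst₂ (Adj G) (sym (right r)) (sym (trans (cong v (sym (+-suc (len P) r))) (right (suc r))))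
              (adjacent Q r (+-cancelˡ-< (len P) r (len Q) t<))
      cross : ∀ {s r} → s ≤ len P → r ≤ len Q → v s ≡ v (len P + r) → s ≡ len P + r
      cross {s} {r} s≤L r≤L e with disjoint s≤L r≤L (trans (sym (left s≤L)) (trans e (right r)))
      ... | refl = trans (injective P s≤L ≤-refl meets-end) (sym (+-identityʳ (len P)))
        where
          meets-end : vertex P s ≡ vertex P (len P)
          meets-end = trans (sym (left s≤L)) (trans e (trans (right 0) (trans (start Q) (sym (end P)))))
      inj : ∀ {s t} → s ≤ len P + len Q → t ≤ len P + len Q → v s ≡ v t → s ≡ t
      inj {s} {t} s≤ t≤ e with splitAt (len P) s | splitAt (len P) t
      ... | inj₁ s<L | inj₁ t<L = injective P (<⇒≤ s<L) (<⇒≤ t<L)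
                                    (trans (sym (left (<⇒≤ s<L))) (trans e (left (<⇒≤ t<L))))
      ... | inj₁ s<L | inj₂ (r , refl) = cross (<⇒≤ s<L) (+-cancelˡ-≤ (len P) r (len Q) t≤) e
      ... | inj₂ (r , refl) | inj₁ t<L = sym (cross (<⇒≤ t<L) (+-cancelˡ-≤ (len P) r (len Q) s≤) (sym e))
      ... | inj₂ (r , refl) | inj₂ (r′ , refl) =
            cong (len P +_) (injective Q (+-cancelˡ-≤ (len P) r (len Q) s≤) (+-cancelˡ-≤ (len P) r′ (len Q) t≤)
              (trans (sym (right r)) (trans e (right r′))))

  closing-cycle : ∀ {x y} (P : Path G x y) {m} → len P ≡ suc (suc m) → Adj G y x → HasCycle G
  closing-cycle P {m} L≡ yx = m , v , v-injective , v-adjacent , v-closes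
    where
      v : Fin (suc (suc (suc m))) → Fin n
      v k = vertex P (toℕ k)
      bound : ∀ k → toℕ {suc (suc (suc m))} k ≤ len P
      bound k = subst (_ ≤_) (sym L≡) (s≤s⁻¹ (Fin.toℕ<n k))
      v-injective : ∀ {k l} → v k ≡ v l → k ≡ l
      v-injective {k} {l} e = Fin.toℕ-injective (injective P (bound k) (bound l) e)
      v-adjacent : ∀ i → Adj G (v (inject₁ i)) (v (fsuc i))
      v-adjacent i = subst (λ u → Adj G (vertex P u) (vertex P (suc (toℕ i)))) (sym (Fin.toℕ-inject₁ i))
                       (adjacent P (toℕ i) (subst (_ ≤_) (sym L≡) (Fin.toℕ<n i)))
      v-closes : Adj G (v (fromℕ (suc (suc m)))) (v fzero)
      v-closes = subst₂ (Adj G)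
                   (sym (trans (cong (vertex P) (trans (Fin.toℕ-fromℕ _) (sym L≡))) (end P)))
                   (sym (start P)) yx

module _ {n} {G : Graph n} (forest : IsForest G) where

  neighbour-path-len≡1 : ∀ {x y} (P : Path G x y) → Adj G y x → len P ≡ 1
  neighbour-path-len≡1 {x} {y} P yx with len P in L≡
  ... | zero = contradiction (subst (Adj G y) x≡y yx) (adj-irrefl G)
    where
      x≡y : x ≡ y
      x≡y = trans (sym (start P)) (trans (cong (vertex P) (sym L≡)) (end P))
  ... | suc zero = refl
  ... | suc (suc m) = ⊥-elim (forest (closing-cycle P L≡ yx))

  Adj? : (∀ x y → Dec (Connected G x y)) → ∀ x y → Dec (Adj G x y)
  Adj? Connected? x y with Connected? x y
  ... | no ¬c = no λ a → ¬c (step a here)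
  ... | yes c with P ← shortcut c | len P ≟ 1
  ... | yes L≡1 = yes (subst₂ (Adj G) (start P) (trans (cong (vertex P) (sym L≡1)) (end P))
                        (adjacent P 0 (subst (0 <_) (sym L≡1) (s≤s z≤n))))
  ... | no L≢1 = no λ a → L≢1 (neighbour-path-len≡1 P (adj-sym G a))

module Components {n} {G : Graph n} {ω} (components : HasComponents G ω) where

  label : Fin n → Fin ω
  label = proj₁ components

  root : Fin ω → Fin n
  root k = proj₁ (proj₁ (proj₂ components) k)

  label-root : ∀ k → label (root k) ≡ k
  label-root k = proj₂ (proj₁ (proj₂ components) k)

  root-injective : ∀ {j k} → root j ≡ root k → j ≡ k
  root-injective {j} {k} e = trans (sym (label-root j)) (trans (cong label e) (label-root k))

  Connected⇒label≡ : ∀ {x y} → Connected G x y → label x ≡ label y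
  Connected⇒label≡ {x} {y} = Equivalence.from (proj₂ (proj₂ components) x y)

  label≡⇒Connected : ∀ {x y} → label x ≡ label y → Connected G x y
  label≡⇒Connected {x} {y} = Equivalence.to (proj₂ (proj₂ components) x y)

  Connected? : ∀ x y → Dec (Connected G x y)
  Connected? x y with label x Fin.≟ label y
  ... | yes e = yes (label≡⇒Connected e)
  ... | no ne = no λ c → ne (Connected⇒label≡ c)

  rootOf : Fin n → Fin n
  rootOf v = root (label v)

  Connected-rootOf : ∀ v → Connected G v (rootOf v)
  Connected-rootOf v = label≡⇒Connected (sym (label-root (label v)))

  rootOf-root : ∀ k → rootOf (root k) ≡ root k
  rootOf-root k = cong root (label-root k)

module ParentDigraph {n} (G : Graph n) (NonRoot : Fin n → Set) (parent : Fin n → Fin n)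
  (parent-adj : ∀ {a} → NonRoot a → Adj G a (parent a))
  (edge⇒parent : ∀ {x y} → Adj G x y → (NonRoot x × parent x ≡ y) ⊎ (NonRoot y × parent y ≡ x))
  {q} (sink : Fin q → Fin n) (sink-injective : ∀ {j k} → sink j ≡ sink k → j ≡ k)
  (sink-root : ∀ k → ¬ NonRoot (sink k)) where

  IsSink : Fin n → Set
  IsSink a = ∃ λ k → sink k ≡ a

  IsSink? : ∀ a → Dec (IsSink a)
  IsSink? a = Fin.any? λ k → sink k Fin.≟ a

  parentDigraph : Digraph n
  parentDigraph x a = IsSink a ⊎ (NonRoot a × (a ≡ x ⊎ parent a ≡ x))

  parent-competes : ∀ {x y} → NonRoot x → parent x ≡ y → PCompete (suc q) parentDigraph x y
  parent-competes {x} {y} nr px≡y = prey , prey-injective , eats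
    where
      prey : Fin (suc q) → Fin n
      prey fzero    = x
      prey (fsuc k) = sink k
      x≢sink : ∀ k → x ≢ sink k
      x≢sink k x≡ = sink-root k (subst NonRoot x≡ nr)
      prey-injective : ∀ {i j} → prey i ≡ prey j → i ≡ j
      prey-injective {fzero}  {fzero}  _ = refl
      prey-injective {fzero}  {fsuc k} e = contradiction e (x≢sink k)
      prey-injective {fsuc k} {fzero}  e = contradiction (sym e) (x≢sink k)
      prey-injective {fsuc j} {fsuc k} e = cong fsuc (sink-injective e)
      eats : ∀ i → parentDigraph x (prey i) × parentDigraph y (prey i)
      eats fzero    = inj₂ (nr , inj₁ refl) , inj₂ (nr , inj₂ px≡y)
      eats (fsuc k) = inj₁ (k , refl) , inj₁ (k , refl)

  shared-non-sink⇒Adj : ∀ {x y a} → x ≢ y → ¬ IsSink a →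
                        parentDigraph x a → parentDigraph y a → Adj G x y
  shared-non-sink⇒Adj _ ¬sink (inj₁ s) _ = contradiction s ¬sink
  shared-non-sink⇒Adj _ ¬sink _ (inj₁ s) = contradiction s ¬sink
  shared-non-sink⇒Adj x≢y _ (inj₂ (_  , inj₁ refl)) (inj₂ (_  , inj₁ refl)) = contradiction refl x≢y
  shared-non-sink⇒Adj _   _ (inj₂ (nr , inj₁ refl)) (inj₂ (_  , inj₂ refl)) = parent-adj nr
  shared-non-sink⇒Adj _   _ (inj₂ (nr , inj₂ refl)) (inj₂ (_  , inj₁ refl)) = adj-sym G (parent-adj nr)
  shared-non-sink⇒Adj x≢y _ (inj₂ (_  , inj₂ refl)) (inj₂ (_  , inj₂ refl)) = contradiction refl x≢y

  competes⇒Adj : ∀ {x y} → x ≢ y → PCompete (suc q) parentDigraph x y → Adj G x y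
  competes⇒Adj x≢y (prey , prey-injective , eats) with Fin.all? (λ i → IsSink? (prey i))
  ... | yes all-sinks = contradiction (Fin.injective⇒≤ index-injective) 1+n≰n
    where
      index : Fin (suc q) → Fin q
      index i = proj₁ (all-sinks i)
      index-injective : ∀ {i j} → index i ≡ index j → i ≡ j
      index-injective {i} {j} e =
        prey-injective (trans (sym (proj₂ (all-sinks i))) (trans (cong sink e) (proj₂ (all-sinks j))))
  ... | no ¬all-sinks with i , ¬sink ← Fin.¬∀⟶∃¬ _ _ (λ i → IsSink? (prey i)) ¬all-sinks =
        shared-non-sink⇒Adj x≢y ¬sink (proj₁ (eats i)) (proj₂ (eats i))

  parentDigraph-competition : IsCompetitionGraphOf (suc q) G parentDigraph
  parentDigraph-competition x y x≢y = mk⇔ Adj⇒competes (competes⇒Adj x≢y)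
    where
      Adj⇒competes : Adj G x y → PCompete (suc q) parentDigraph x y
      Adj⇒competes xy with edge⇒parent xy
      ... | inj₁ (nr , px≡y) = parent-competes nr px≡y
      ... | inj₂ (nr , py≡x) with prey , inj , eats ← parent-competes nr py≡x =
            prey , inj , λ i → proj₂ (eats i) , proj₁ (eats i)

module BreadthFirst {n} {G : Graph n} (forest : IsForest G) {ω} (components : HasComponents G ω) where

  open Components components

  Reach : ℕ → Fin n → Fin n → Set
  Reach zero    v r = v ≡ r
  Reach (suc k) v r = ∃ λ u → Adj G v u × Reach k u r

  Reach? : ∀ k v r → Dec (Reach k v r)
  Reach? zero    v r = v Fin.≟ r
  Reach? (suc k) v r = Fin.any? λ u → Adj? forest Connected? v u ×-dec Reach? k u r

  Connected⇒Reach : ∀ {v r} → Connected G v r → ∃ λ k → Reach k v r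
  Connected⇒Reach here = 0 , refl
  Connected⇒Reach (step {y = u} a c) with k , R ← Connected⇒Reach c = suc k , u , a , R

  next : ∀ k {v r} → Reach k v r → Fin n
  next zero    {v} _ = v
  next (suc k) (u , _) = u

  next-adj : ∀ k {v r} (R : Reach k v r) → 0 < k → Adj G v (next k R)
  next-adj (suc k) (u , a , _) _ = a

  next-reach : ∀ k {v r} (R : Reach k v r) → Reach (k ∸ 1) (next k R) r
  next-reach zero    R           = R
  next-reach (suc k) (u , _ , R) = R

  next-Connected : ∀ k {v r} (R : Reach k v r) → Connected G v (next k R)
  next-Connected zero    _           = here
  next-Connected (suc k) (u , a , _) = step a here

  shortestReach : ∀ v → ∃ λ k → Reach k v (rootOf v) × (∀ {j} → j < k → ¬ Reach j v (rootOf v))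
  shortestReach v = least (λ k → Reach? k v (rootOf v)) (proj₂ (Connected⇒Reach (Connected-rootOf v)))

  depth : Fin n → ℕ
  depth v = proj₁ (shortestReach v)

  depth-reach : ∀ v → Reach (depth v) v (rootOf v)
  depth-reach v = proj₁ (proj₂ (shortestReach v))

  depth-least : ∀ v {k} → Reach k v (rootOf v) → depth v ≤ k
  depth-least v R = ≮⇒≥ λ k<d → proj₂ (proj₂ (shortestReach v)) k<d R

  depth≡0⇒rootOf : ∀ {v} → depth v ≡ 0 → v ≡ rootOf v
  depth≡0⇒rootOf {v} d≡0 = subst (λ k → Reach k v (rootOf v)) d≡0 (depth-reach v)

  depth-root : ∀ k → depth (root k) ≡ 0
  depth-root k = n≤0⇒n≡0 (depth-least (root k) (sym (rootOf-root k)))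

  parent : Fin n → Fin n
  parent v = next (depth v) (depth-reach v)

  parent-adj : ∀ {v} → 0 < depth v → Adj G v (parent v)
  parent-adj {v} = next-adj (depth v) (depth-reach v)

  parent-of-root : ∀ {v} → depth v ≡ 0 → parent v ≡ v
  parent-of-root {v} = go (depth v) (depth-reach v)
    where
      go : ∀ k (R : Reach k v (rootOf v)) → k ≡ 0 → next k R ≡ v
      go zero _ _ = refl

  rootOf-parent : ∀ v → rootOf (parent v) ≡ rootOf v
  rootOf-parent v = cong root (sym (Connected⇒label≡ (next-Connected (depth v) (depth-reach v))))

  depth-parent : ∀ v → depth (parent v) ≡ depth v ∸ 1
  depth-parent v = ≤-antisym
    (depth-least (parent v) (subst (Reach _ (parent v)) (sym (rootOf-parent v)) (next-reach (depth v) (depth-reach v))))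
    (m≤n+o⇒m∸n≤o (depth v) 1 depth≤1+depth-parent)
    where
      depth≤1+depth-parent : depth v ≤ suc (depth (parent v))
      depth≤1+depth-parent with depth v ≟ 0
      ... | yes d≡0 = subst (_≤ suc (depth (parent v))) (sym d≡0) z≤n
      ... | no d≢0 = depth-least v (parent v , parent-adj (n≢0⇒n>0 d≢0) ,
                       subst (Reach _ (parent v)) (rootOf-parent v) (depth-reach (parent v)))

  ancestor : ℕ → Fin n → Fin n
  ancestor zero    v = v
  ancestor (suc t) v = parent (ancestor t v)

  depth-ancestor : ∀ t v → depth (ancestor t v) ≡ depth v ∸ t
  depth-ancestor zero    v = refl
  depth-ancestor (suc t) v = begin
    depth (parent (ancestor t v)) ≡⟨ depth-parent (ancestor t v) ⟩
    depth (ancestor t v) ∸ 1      ≡⟨ cong (_∸ 1) (depth-ancestor t v) ⟩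
    depth v ∸ t ∸ 1               ≡⟨ ∸-+-assoc (depth v) t 1 ⟩
    depth v ∸ (t + 1)             ≡⟨ cong (depth v ∸_) (+-comm t 1) ⟩
    depth v ∸ suc t               ∎
    where open ≡-Reasoning

  rootOf-ancestor : ∀ t v → rootOf (ancestor t v) ≡ rootOf v
  rootOf-ancestor zero    v = refl
  rootOf-ancestor (suc t) v = trans (rootOf-parent (ancestor t v)) (rootOf-ancestor t v)

  ancestor-depth : ∀ v → ancestor (depth v) v ≡ rootOf v
  ancestor-depth v = trans (depth≡0⇒rootOf (trans (depth-ancestor (depth v) v) (n∸n≡0 (depth v))))
                           (rootOf-ancestor (depth v) v)

  ancestor-adj : ∀ {t v} → t < depth v → Adj G (ancestor t v) (ancestor (suc t) v)
  ancestor-adj {t} {v} t<d = parent-adj (subst (0 <_) (sym (depth-ancestor t v)) (m<n⇒0<n∸m t<d))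

  ancestorPath : ∀ v {k m} → k ≤ depth v → ancestor k v ≡ m → Path G v m
  ancestorPath v {k} k≤d e = record
    { len = k ; vertex = λ t → ancestor t v ; start = refl ; end = e
    ; adjacent = λ t t<k → ancestor-adj (<-≤-trans t<k k≤d)
    ; injective = λ {s} {t} s≤k t≤k e′ → ∸-cancelˡ-≡ (≤-trans s≤k k≤d) (≤-trans t≤k k≤d)
        (trans (sym (depth-ancestor s v)) (trans (cong depth e′) (depth-ancestor t v))) }

  -- The ancestor chains of x and y first meet after i + δ and i steps; the resulting path from
  -- x to y has length 2i + δ, which the forest forces to be 1.
  parent-edge : ∀ {x y} → Adj G x y → depth y ≤ depth x → parent x ≡ y
  parent-edge {x} {y} xy dy≤dx = parent-meets (m+n+m≡1⇒m≡0×n≡1 i δ (neighbour-path-len≡1 forest P (adj-sym G xy)))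
    where
      δ : ℕ
      δ = depth x ∸ depth y
      dy+δ≡dx : depth y + δ ≡ depth x
      dy+δ≡dx = m+[n∸m]≡n dy≤dx
      Meet : ℕ → Set
      Meet j = ancestor (j + δ) x ≡ ancestor j y
      meet-at-root : Meet (depth y)
      meet-at-root = begin
        ancestor (depth y + δ) x ≡⟨ cong (λ k → ancestor k x) dy+δ≡dx ⟩
        ancestor (depth x) x     ≡⟨ ancestor-depth x ⟩
        rootOf x                 ≡⟨ cong root (Connected⇒label≡ (step xy here)) ⟩
        rootOf y                 ≡⟨ sym (ancestor-depth y) ⟩
        ancestor (depth y) y     ∎
        where open ≡-Reasoning
      first : ∃ λ j → Meet j × (∀ {k} → k < j → ¬ Meet k)
      first = least (λ j → ancestor (j + δ) x Fin.≟ ancestor j y) {depth y} meet-at-root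
      i = proj₁ first
      meet : Meet i
      meet = proj₁ (proj₂ first)
      before : ∀ {j} → j < i → ¬ Meet j
      before = proj₂ (proj₂ first)
      i≤dy : i ≤ depth y
      i≤dy = ≮⇒≥ λ dy<i → before dy<i meet-at-root
      i+δ≤dx : i + δ ≤ depth x
      i+δ≤dx = subst (i + δ ≤_) dy+δ≡dx (+-monoˡ-≤ δ i≤dy)
      disjoint : ∀ {s t} → s ≤ i + δ → t ≤ i → ancestor s x ≡ ancestor (i ∸ t) y → t ≡ 0
      disjoint {s} {zero}  _   _   _ = refl
      disjoint {s} {suc t} s≤ t≤i e = contradiction (subst (λ k → ancestor k x ≡ _) s≡ e)
                                        (before (∸-monoʳ-< (s≤s z≤n) t≤i))
        where
          s≡ : s ≡ (i ∸ suc t) + δ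
          s≡ = m∸o≡n∸p⇒o≡p+[m∸n] dy≤dx (≤-trans s≤ i+δ≤dx) (≤-trans (m∸n≤m i (suc t)) i≤dy)
                 (trans (sym (depth-ancestor s x)) (trans (cong depth e) (depth-ancestor (i ∸ suc t) y)))
      P : Path G x y
      P = join (ancestorPath x i+δ≤dx meet) (reverse (ancestorPath y i≤dy refl)) disjoint
      parent-meets : i ≡ 0 × δ ≡ 1 → parent x ≡ y
      parent-meets (i≡0 , δ≡1) = subst₂ (λ j d → ancestor (j + d) x ≡ ancestor j y) i≡0 δ≡1 meet

  parent-non-root : ∀ {x y} → Adj G x y → parent x ≡ y → 0 < depth x
  parent-non-root {x} xy px≡y = n≢0⇒n>0 λ d≡0 →
    adj-irrefl G (subst (Adj G x) (trans (sym px≡y) (parent-of-root d≡0)) xy)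

  edge⇒parent : ∀ {x y} → Adj G x y → (0 < depth x × parent x ≡ y) ⊎ (0 < depth y × parent y ≡ x)
  edge⇒parent {x} {y} xy with ≤-total (depth y) (depth x)
  ... | inj₁ dy≤dx = inj₁ (parent-non-root xy px≡y , px≡y)
    where
      px≡y : parent x ≡ y
      px≡y = parent-edge xy dy≤dx
  ... | inj₂ dx≤dy = inj₂ (parent-non-root (adj-sym G xy) py≡x , py≡x)
    where
      py≡x : parent y ≡ x
      py≡x = parent-edge (adj-sym G xy) dx≤dy

  isPCompetitionGraph : ∀ {q} → q ≤ ω → IsPCompetitionGraph (suc q) G
  isPCompetitionGraph {q} q≤ω = parentDigraph , parentDigraph-competition
    where
      sink : Fin q → Fin n
      sink k = root (inject≤ k q≤ω)
      open ParentDigraph G (λ a → 0 < depth a) parent parent-adj edge⇒parent sink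
             (λ e → Fin.inject≤-injective q≤ω q≤ω _ _ (root-injective e))
             (λ k pos → <⇒≢ pos (sym (depth-root (inject≤ k q≤ω))))

components<vertices : ∀ {n} {G : Graph n} {ω} → 1 ≤ n → HasComponents G ω → NoTrivialComponent G → ω < n
components<vertices {n} {G} {ω} 1≤n components nontrivial = Fin.injective⇒≤ f-injective
  where
    open Components components
    r : Fin n
    r = rootOf (fromℕ< 1≤n)
    y : Fin n
    y = proj₁ (nontrivial r)
    y≢r : y ≢ r
    y≢r = proj₁ (proj₂ (nontrivial r))
    y≢root : ∀ k → y ≢ root k
    y≢root k y≡ = y≢r (begin
      y               ≡⟨ y≡ ⟩
      root k          ≡⟨ sym (rootOf-root k) ⟩
      rootOf (root k) ≡⟨ cong rootOf (sym y≡) ⟩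
      rootOf y        ≡⟨ cong root (sym (Connected⇒label≡ (proj₂ (proj₂ (nontrivial r))))) ⟩
      rootOf r        ≡⟨ rootOf-root _ ⟩
      r               ∎)
      where open ≡-Reasoning
    f : Fin (suc ω) → Fin n
    f fzero    = y
    f (fsuc k) = root k
    f-injective : ∀ {i j} → f i ≡ f j → i ≡ j
    f-injective {fzero}  {fzero}  _ = refl
    f-injective {fzero}  {fsuc k} e = contradiction e (y≢root k)
    f-injective {fsuc k} {fzero}  e = contradiction (sym e) (y≢root k)
    f-injective {fsuc j} {fsuc k} e = cong fsuc (root-injective e)

mainTheorem19 : ∀ {n} (G : Graph n) (ω : ℕ) → 1 ≤ n → IsForest G → HasComponents G ω →
                  NoTrivialComponent G → ∀ p → 1 ≤ p → p ≤ suc ω → InUpsilon p G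
mainTheorem19 G ω 1≤n forest components nontrivial (suc q) 1≤p p≤1+ω =
  (1≤p , ≤-trans p≤1+ω (components<vertices 1≤n components nontrivial)) ,
  BreadthFirst.isPCompetitionGraph forest components (s≤s⁻¹ p≤1+ω)
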